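{- Let $n\in\overline{C_2}$. Then in the group $G_n$ of units of $\mathbb{Z}_n$, the element $-1$ is an odd power of $2$, and $\mathrm{ord}_n(2)\equiv 2\pmod 4$.
   Context: $\mathrm{ord}_n(x)$ is the multiplicative order of a unit $x$ modulo $n$. $C_2$ is the set of (odd) primes $p$ with $\mathrm{ord}_p(2)\equiv2\pmod4$. $\overline{C_2}$ is its multiplicative closure: the set of all products of one or more (not necessarily distinct) primes from $C_2$. -}

module Defs where

open import Data.Nat using (ℕ; suc; _*_; _^_; _%_; _≤_; _<_; _∸_; NonZero)
open import Data.Nat.Primality using (Prime)
open import Data.Product using (_×_; ∃-syntax)
open import Relation.Binary.PropositionalEquality using (_≡_)
open import Relation.Nullary using (¬_)

infix 4 _≡_[mod_]
_≡_[mod_] : ℕ → ℕ → (n : ℕ) → .{{NonZero n}} → Set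
a ≡ b [mod n ] = a % n ≡ b % n

IsOrd : (n : ℕ) → .{{NonZero n}} → ℕ → ℕ → Set
IsOrd n x k = (1 ≤ k) × (x ^ k ≡ 1 [mod n ])
            × (∀ j → 1 ≤ j → j < k → ¬ (x ^ j ≡ 1 [mod n ]))

OrdMod4 : (n : ℕ) → .{{NonZero n}} → ℕ → ℕ → Set
OrdMod4 n x r = ∃[ k ] (IsOrd n x k × k % 4 ≡ r)

C₂ : (p : ℕ) → .{{NonZero p}} → Set
C₂ p = Prime p × (p % 2 ≡ 1) × OrdMod4 p 2 2

data C₂-closure : ℕ → Set where
  prime : ∀ p → .{{_ : NonZero p}} → C₂ p → C₂-closure p
  mul   : ∀ {m n} → C₂-closure m → C₂-closure n → C₂-closure (m * n)

-- For p ∈ C₂ with ord_p(2) = 2j, j odd, the number x = 2^j squares to 1 but is not 1 modulo p,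
-- so p ∣ 2^j + 1.  Divisibility of 2^a + 1 for some odd a passes to products, even with
-- repeated prime factors, because x^e + 1 ≡ e(x + 1) modulo (x + 1)² for odd e.  Finally,
-- 2^a ≡ -1 (mod n) with a odd forces the order of 2 to divide 2a but not a, i.e. to be twice
-- an odd number.
module Submission where

open import Defs
open import Data.Nat using (ℕ; _∸_; _^_; _%_; NonZero)
open import Data.Product using (_×_; ∃-syntax)
open import Relation.Binary.PropositionalEquality using (_≡_)

open import Data.Nat using (zero; suc; _+_; _*_; _/_; _≤_; _<_; z≤n; s≤s; z<s; _≟_; >-nonZero; nonTrivial⇒n>1)
open import Data.Nat.Properties
open import Data.Nat.DivMod
open import Data.Nat.Divisibility
open import Data.Nat.Induction using (<-rec)
open import Data.Nat.Primality using (Prime; prime?; euclidsLemma; prime⇒nonTrivial)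
open import Data.Nat.Tactic.RingSolver using (solve; solve-∀)
open import Data.List using (_∷_; [])
open import Data.Product using (_,_)
open import Data.Sum using (_⊎_; inj₁; inj₂; [_,_]′; fromInj₂)
open import Relation.Nullary using (¬_; yes; no; contradiction)
open import Relation.Nullary.Decidable using (from-yes)
open import Relation.Unary using (Pred; Decidable)
open import Relation.Binary.PropositionalEquality using (refl; sym; trans; cong; cong₂; subst; module ≡-Reasoning)

open ≡-Reasoning

2-is-prime : Prime 2
2-is-prime = from-yes (prime? 2)

odd⇒%2≡1 : ∀ {a} → 2 ∤ a → a % 2 ≡ 1
odd⇒%2≡1 {a} 2∤a with a % 2 in eq | m%n<n a 2
... | 0           | _               = contradiction (m%n≡0⇒n∣m a 2 eq) 2∤a
... | 1           | _               = refl
... | suc (suc _) | s≤s (s≤s ())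

%2≡1⇒odd : ∀ {a} → a % 2 ≡ 1 → 2 ∤ a
%2≡1⇒odd {a} a%2≡1 2∣a = 0≢1+n (trans (sym (n∣m⇒m%n≡0 a 2 2∣a)) a%2≡1)

odd⇒≡1+[/2]*2 : ∀ {a} → 2 ∤ a → a ≡ 1 + (a / 2) * 2
odd⇒≡1+[/2]*2 {a} 2∤a = trans (m≡m%n+[m/n]*n a 2) (cong (_+ (a / 2) * 2) (odd⇒%2≡1 2∤a))

odd⇒>0 : ∀ {a} → 2 ∤ a → 0 < a
odd⇒>0 {zero}  2∤0 = contradiction (2 ∣0) 2∤0
odd⇒>0 {suc a} _   = s≤s z≤n

odd-* : ∀ {m n} → 2 ∤ m → 2 ∤ n → 2 ∤ m * n
odd-* {m} {n} 2∤m 2∤n 2∣mn = [ 2∤m , 2∤n ]′ (euclidsLemma m n 2-is-prime 2∣mn)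

odd*2%4≡2 : ∀ {m} → 2 ∤ m → (m * 2) % 4 ≡ 2
odd*2%4≡2 {m} 2∤m = begin
  (m * 2) % 4  ≡⟨ sym (m%n*o≡m*o%[n*o] m 2 2) ⟩
  m % 2 * 2    ≡⟨ cong (_* 2) (odd⇒%2≡1 2∤m) ⟩
  2            ∎

%4≡2⇒≡odd+odd : ∀ {k} → k % 4 ≡ 2 → ∃[ j ] (2 ∤ j × k ≡ j + j)
%4≡2⇒≡odd+odd {k} k%4≡2 = 1 + q * 2 , %2≡1⇒odd ([m+kn]%n≡m%n 1 q 2) , (begin
  k                          ≡⟨ m≡m%n+[m/n]*n k 4 ⟩
  k % 4 + q * 4              ≡⟨ cong (_+ q * 4) k%4≡2 ⟩
  2 + q * 4                  ≡⟨ regroup q ⟩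
  (1 + q * 2) + (1 + q * 2)  ∎)
  where
  q = k / 4
  regroup : ∀ q → 2 + q * 4 ≡ (1 + q * 2) + (1 + q * 2)
  regroup = solve-∀

k∣2a∧k∤a⇒k%4≡2 : ∀ {k a} → 2 ∤ a → k ∣ 2 * a → k ∤ a → k % 4 ≡ 2
k∣2a∧k∤a⇒k%4≡2 {k} {a} 2∤a (divides q 2a≡qk) k∤a
  with euclidsLemma q k 2-is-prime (divides a (trans (sym 2a≡qk) (*-comm 2 a)))
... | inj₁ (divides q′ refl) = contradiction (divides q′ a≡q′k) k∤a
  where
  a≡q′k : a ≡ q′ * k
  a≡q′k = *-cancelˡ-≡ a (q′ * k) 2 (trans 2a≡qk (solve (q′ ∷ k ∷ [])))
... | inj₂ (divides k′ refl) = odd*2%4≡2 2∤k′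
  where
  a≡qk′ : a ≡ q * k′
  a≡qk′ = *-cancelˡ-≡ a (q * k′) 2 (trans 2a≡qk (solve (q ∷ k′ ∷ [])))
  2∤k′ : 2 ∤ k′
  2∤k′ 2∣k′ = 2∤a (∣-trans 2∣k′ (divides q a≡qk′))

module _ {n : ℕ} .{{_ : NonZero n}} where

  *-cong-mod : ∀ {a b c d} → a ≡ b [mod n ] → c ≡ d [mod n ] → a * c ≡ b * d [mod n ]
  *-cong-mod {a} {b} {c} {d} a≡b c≡d = begin
    a * c % n              ≡⟨ %-distribˡ-* a c n ⟩
    (a % n) * (c % n) % n  ≡⟨ cong₂ (λ u v → u * v % n) a≡b c≡d ⟩
    (b % n) * (d % n) % n  ≡⟨ sym (%-distribˡ-* b d n) ⟩
    b * d % n              ∎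

  ≡[mod]⇒∣∸ : ∀ {a b} → a ≡ b [mod n ] → n ∣ a ∸ b
  ≡[mod]⇒∣∸ {a} {b} a≡b = divides (a / n ∸ b / n) (begin
    a ∸ b
      ≡⟨ cong₂ _∸_ (m≡m%n+[m/n]*n a n) (m≡m%n+[m/n]*n b n) ⟩
    (a % n + a / n * n) ∸ (b % n + b / n * n)
      ≡⟨ cong (λ r → (r + a / n * n) ∸ (b % n + b / n * n)) a≡b ⟩
    (b % n + a / n * n) ∸ (b % n + b / n * n)
      ≡⟨ [m+n]∸[m+o]≡n∸o (b % n) _ _ ⟩
    a / n * n ∸ b / n * n
      ≡⟨ sym (*-distribʳ-∸ n (a / n) (b / n)) ⟩
    (a / n ∸ b / n) * n ∎)

  ∣+1⇒sq≡1 : ∀ {y} → n ∣ y + 1 → y * y ≡ 1 [mod n ]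
  ∣+1⇒sq≡1 {y} n∣y+1 = begin
    y * y % n              ≡⟨ sym (%-remove-+ʳ (y * y) n∣y+1) ⟩
    (y * y + (y + 1)) % n  ≡⟨ cong (_% n) (regroup y) ⟩
    (1 + y * (y + 1)) % n  ≡⟨ %-remove-+ʳ 1 (∣n⇒∣m*n y n∣y+1) ⟩
    1 % n                  ∎
    where
    regroup : ∀ y → y * y + (y + 1) ≡ 1 + y * (y + 1)
    regroup = solve-∀

∣+1⇒≡-1 : ∀ {n} .{{_ : NonZero n}} {y} → n ∣ y + 1 → y ≡ n ∸ 1 [mod n ]
∣+1⇒≡-1 {suc u} {y} (divides zero y+1≡0) = contradiction (trans (+-comm 1 y) y+1≡0) 1+n≢0
∣+1⇒≡-1 {suc u} {y} (divides (suc q) y+1≡[1+q]n) =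
  trans (cong (_% suc u) y≡u+qn) ([m+kn]%n≡m%n u q (suc u))
  where
  y≡u+qn : y ≡ u + q * suc u
  y≡u+qn = suc-injective (trans (+-comm 1 y) y+1≡[1+q]n)

-1≢1 : ∀ {n} .{{_ : NonZero n}} → 2 < n → ¬ (n ∸ 1 ≡ 1 [mod n ])
-1≢1 {suc (suc (suc u))} (s≤s (s≤s (s≤s _))) -1≡1 =
  1+n≢0 (suc-injective (trans (sym (m≤n⇒m%n≡m (≤-refl {suc (suc u)}))) -1≡1))

prime⇒sq≡1⇒≡±1 : ∀ {p} .{{_ : NonZero p}} {y} → Prime p → y * y ≡ 1 [mod p ] →
                 y ≡ 1 [mod p ] ⊎ p ∣ y + 1
prime⇒sq≡1⇒≡±1 {p} {zero} _ 0≡1 = inj₂ (m%n≡0⇒n∣m 1 p (trans (sym 0≡1) (n∣m⇒m%n≡0 0 p (p ∣0))))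
prime⇒sq≡1⇒≡±1 {p} {suc w} pp y²≡1 =
  [ (λ p∣w → inj₁ (%-remove-+ʳ 1 p∣w)) , inj₂ ]′ (euclidsLemma w (suc w + 1) pp p∣w[y+1])
  where
  y²≡w[y+1]+1 : suc w * suc w ≡ w * (suc w + 1) + 1
  y²≡w[y+1]+1 = solve (w ∷ [])
  p∣w[y+1] : p ∣ w * (suc w + 1)
  p∣w[y+1] = subst (p ∣_) (m+n∸n≡m _ 1) (≡[mod]⇒∣∸ (subst (λ t → t % p ≡ 1 % p) y²≡w[y+1]+1 y²≡1))

least-witness : ∀ {p} {P : Pred ℕ p} → Decidable P → ∀ {m} → P m →
                ∃[ k ] (P k × ∀ {j} → j < k → ¬ P j)
least-witness {P = P} P? {m} = <-rec (λ m → P m → Least) step m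
  where
  Least = ∃[ k ] (P k × ∀ {j} → j < k → ¬ P j)
  step : ∀ m → (∀ {j} → j < m → P j → Least) → P m → Least
  step m below Pm with anyUpTo? P? m
  ... | yes (j , j<m , Pj) = below j<m Pj
  ... | no none            = m , Pm , λ j<m Pj → none (_ , j<m , Pj)

module _ {n : ℕ} .{{_ : NonZero n}} {x : ℕ} where

  pow-periodic : ∀ {k} → x ^ k ≡ 1 [mod n ] → ∀ q r → x ^ (r + q * k) ≡ x ^ r [mod n ]
  pow-periodic {k} xᵏ≡1 zero    r = cong (λ e → x ^ e % n) (+-identityʳ r)
  pow-periodic {k} xᵏ≡1 (suc q) r = begin
    x ^ (r + (k + q * k)) % n      ≡⟨ cong (λ e → x ^ e % n) (+-comm-middle r k (q * k)) ⟩
    x ^ (k + (r + q * k)) % n      ≡⟨ cong (_% n) (^-distribˡ-+-* x k (r + q * k)) ⟩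
    x ^ k * x ^ (r + q * k) % n    ≡⟨ *-cong-mod xᵏ≡1 (pow-periodic xᵏ≡1 q r) ⟩
    1 * x ^ r % n                  ≡⟨ cong (_% n) (*-identityˡ (x ^ r)) ⟩
    x ^ r % n                      ∎
    where
    +-comm-middle : ∀ a b c → a + (b + c) ≡ b + (a + c)
    +-comm-middle = solve-∀

  pow-∣ : ∀ {k m} → x ^ k ≡ 1 [mod n ] → k ∣ m → x ^ m ≡ 1 [mod n ]
  pow-∣ xᵏ≡1 (divides q refl) = pow-periodic xᵏ≡1 q 0

  order-∣ : ∀ {k m} → IsOrd n x k → x ^ m ≡ 1 [mod n ] → k ∣ m
  order-∣ {k} {m} (1≤k , xᵏ≡1 , minimal) xᵐ≡1 = m%n≡0⇒n∣m m k m%k≡0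
    where
    instance _ = >-nonZero 1≤k
    xᵐᐟᵏ≡1 : x ^ (m % k) ≡ 1 [mod n ]
    xᵐᐟᵏ≡1 = begin
      x ^ (m % k) % n                ≡⟨ sym (pow-periodic xᵏ≡1 (m / k) (m % k)) ⟩
      x ^ (m % k + m / k * k) % n    ≡⟨ cong (λ e → x ^ e % n) (sym (m≡m%n+[m/n]*n m k)) ⟩
      x ^ m % n                      ≡⟨ xᵐ≡1 ⟩
      1 % n                          ∎
    m%k≡0 : m % k ≡ 0
    m%k≡0 with m % k | m%n<n m k | xᵐᐟᵏ≡1
    ... | zero  | _   | _    = refl
    ... | suc r | r<k | xʳ≡1 = contradiction xʳ≡1 (minimal (suc r) (s≤s z≤n) r<k)

  order-exists : ∀ {m} → 1 ≤ m → x ^ m ≡ 1 [mod n ] → ∃[ k ] IsOrd n x k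
  order-exists {suc m} (s≤s _) xᵐ≡1 with least-witness (λ j → x ^ suc j % n ≟ 1 % n) {m} xᵐ≡1
  ... | k , xᵏ⁺¹≡1 , minimal = suc k , s≤s z≤n , xᵏ⁺¹≡1 , below
    where
    below : ∀ j → 1 ≤ j → j < suc k → ¬ (x ^ j ≡ 1 [mod n ])
    below (suc j) _ (s≤s j<k) = minimal j<k

  odd-pow-∣+1⇒order≡2[mod4] : ∀ {a} → 2 < n → 2 ∤ a → n ∣ x ^ a + 1 → OrdMod4 n x 2
  odd-pow-∣+1⇒order≡2[mod4] {a} 2<n 2∤a n∣xᵃ+1 =
    order≡2[mod4] (order-exists (≤-trans (odd⇒>0 2∤a) (m≤m+n a (a + 0))) x²ᵃ≡1)
    where
    x²ᵃ≡1 : x ^ (2 * a) ≡ 1 [mod n ]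
    x²ᵃ≡1 = begin
      x ^ (a + (a + 0)) % n  ≡⟨ cong (λ e → x ^ (a + e) % n) (+-identityʳ a) ⟩
      x ^ (a + a) % n        ≡⟨ cong (_% n) (^-distribˡ-+-* x a a) ⟩
      x ^ a * x ^ a % n      ≡⟨ ∣+1⇒sq≡1 n∣xᵃ+1 ⟩
      1 % n                  ∎
    order≡2[mod4] : ∃[ k ] IsOrd n x k → OrdMod4 n x 2
    order≡2[mod4] (k , ord@(_ , xᵏ≡1 , _)) = k , ord , k∣2a∧k∤a⇒k%4≡2 2∤a (order-∣ ord x²ᵃ≡1) k∤a
      where
      k∤a : k ∤ a
      k∤a k∣a = -1≢1 2<n (trans (sym (∣+1⇒≡-1 n∣xᵃ+1)) (pow-∣ xᵏ≡1 k∣a))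

-- x ^ e + 1 ≡ e (x + 1) modulo (x + 1)², both sides shifted by multiples of (x + 1)² to avoid ∸.
odd-pow+1≡ : ∀ x .{{_ : NonZero x}} {e} → 2 ∤ e →
             ∃[ A ] ∃[ B ] ((x + 1) * (x + 1) * A + (x ^ e + 1) ≡ (x + 1) * (x + 1) * B + e * (x + 1))
odd-pow+1≡ x@(suc w) {e} 2∤e = subst P (sym (odd⇒≡1+[/2]*2 2∤e)) (P[1+2r] (e / 2))
  where
  P : ℕ → Set
  P e = ∃[ A ] ∃[ B ] ((x + 1) * (x + 1) * A + (x ^ e + 1) ≡ (x + 1) * (x + 1) * B + e * (x + 1))
  x¹+1≡1*[x+1] : ∀ x → (x + 1) * (x + 1) * 0 + (x * 1 + 1) ≡ (x + 1) * (x + 1) * 0 + 1 * (x + 1)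
  x¹+1≡1*[x+1] = solve-∀
  pull-x² : ∀ x A X → (x + 1) * (x + 1) * (x * x * A + 1) + (x * (x * X) + 1) + x * x
                    ≡ x * x * ((x + 1) * (x + 1) * A + (X + 1)) + (x + 1) * (x + 1) + 1
  pull-x² = solve-∀
  push-x² : ∀ w B e → let x = suc w in
            x * x * ((x + 1) * (x + 1) * B + e * (x + 1)) + (x + 1) * (x + 1) + 1
            ≡ (x + 1) * (x + 1) * (x * x * B + e * w) + (2 + e) * (x + 1) + x * x
  push-x² = solve-∀
  P[1+2r] : ∀ r → P (1 + r * 2)
  P[1+2r] zero    = 0 , 0 , x¹+1≡1*[x+1] x
  P[1+2r] (suc r) with P[1+2r] r
  ... | A , B , eq = x * x * A + 1 , x * x * B + (1 + r * 2) * w , +-cancelʳ-≡ (x * x) _ _ (begin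
    (x + 1) * (x + 1) * (x * x * A + 1) + (x ^ (3 + r * 2) + 1) + x * x
      ≡⟨ pull-x² x A (x ^ (1 + r * 2)) ⟩
    x * x * ((x + 1) * (x + 1) * A + (x ^ (1 + r * 2) + 1)) + (x + 1) * (x + 1) + 1
      ≡⟨ cong (λ t → x * x * t + (x + 1) * (x + 1) + 1) eq ⟩
    x * x * ((x + 1) * (x + 1) * B + (1 + r * 2) * (x + 1)) + (x + 1) * (x + 1) + 1
      ≡⟨ push-x² w B (1 + r * 2) ⟩
    (x + 1) * (x + 1) * (x * x * B + (1 + r * 2) * w) + (3 + r * 2) * (x + 1) + x * x ∎)

odd-pow+1-∣ : ∀ {d} x .{{_ : NonZero x}} {e} → 2 ∤ e →
              d ∣ e * (x + 1) → d ∣ (x + 1) * (x + 1) → d ∣ x ^ e + 1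
odd-pow+1-∣ {d} x 2∤e d∣e[x+1] d∣[x+1]² with odd-pow+1≡ x 2∤e
... | A , B , eq = ∣m+n∣m⇒∣n (subst (d ∣_) (sym eq) (∣m∣n⇒∣m+n (∣m⇒∣m*n B d∣[x+1]²) d∣e[x+1]))
                             (∣m⇒∣m*n A d∣[x+1]²)

∣+1⇒∣odd-pow+1 : ∀ {d} x .{{_ : NonZero x}} {e} → 2 ∤ e → d ∣ x + 1 → d ∣ x ^ e + 1
∣+1⇒∣odd-pow+1 x {e} 2∤e d∣x+1 = odd-pow+1-∣ x 2∤e (∣n⇒∣m*n e d∣x+1) (∣m⇒∣m*n (x + 1) d∣x+1)

*-∣odd-pow+1 : ∀ {m n} x .{{_ : NonZero x}} → 2 ∤ n → m ∣ x + 1 → n ∣ x + 1 → m * n ∣ x ^ n + 1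
*-∣odd-pow+1 {m} {n} x 2∤n m∣x+1 n∣x+1 = odd-pow+1-∣ x 2∤n
  (subst (m * n ∣_) (*-comm (x + 1) n) (*-pres-∣ m∣x+1 (∣-refl {n})))
  (*-pres-∣ m∣x+1 n∣x+1)

infix 4 _∣_^odd+1
_∣_^odd+1 : ℕ → ℕ → Set
n ∣ x ^odd+1 = ∃[ a ] (2 ∤ a × n ∣ x ^ a + 1)

∣^odd+1-* : ∀ {x m n} .{{_ : NonZero x}} → 2 ∤ n → m ∣ x ^odd+1 → n ∣ x ^odd+1 → m * n ∣ x ^odd+1
∣^odd+1-* {x} {m} {n} 2∤n (a , 2∤a , m∣xᵃ+1) (b , 2∤b , n∣xᵇ+1) =
  a * b * n , odd-* (odd-* 2∤a 2∤b) 2∤n ,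
  subst (λ e → m * n ∣ e + 1) (^-*-assoc x (a * b) n)
        (*-∣odd-pow+1 (x ^ (a * b)) {{m^n≢0 x (a * b)}} 2∤n m∣xᵃᵇ+1 n∣xᵃᵇ+1)
  where
  m∣xᵃᵇ+1 : m ∣ x ^ (a * b) + 1
  m∣xᵃᵇ+1 = subst (λ e → m ∣ e + 1) (^-*-assoc x a b)
                  (∣+1⇒∣odd-pow+1 (x ^ a) {{m^n≢0 x a}} 2∤b m∣xᵃ+1)
  n∣xᵃᵇ+1 : n ∣ x ^ (a * b) + 1
  n∣xᵃᵇ+1 = subst (λ e → n ∣ e + 1) (trans (^-*-assoc x b a) (cong (x ^_) (*-comm b a)))
                  (∣+1⇒∣odd-pow+1 (x ^ b) {{m^n≢0 x b}} 2∤a n∣xᵇ+1)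

prime∧order≡2[mod4]⇒∣^odd+1 : ∀ {p x} .{{_ : NonZero p}} → Prime p → OrdMod4 p x 2 → p ∣ x ^odd+1
prime∧order≡2[mod4]⇒∣^odd+1 {p} {x} pp (k , (_ , xᵏ≡1 , minimal) , k%4≡2) with %4≡2⇒≡odd+odd {k} k%4≡2
... | j , 2∤j , refl = j , 2∤j , fromInj₂ (λ xʲ≡1 → contradiction xʲ≡1 xʲ≢1) (prime⇒sq≡1⇒≡±1 pp x²ʲ≡1)
  where
  x²ʲ≡1 : x ^ j * x ^ j ≡ 1 [mod p ]
  x²ʲ≡1 = trans (cong (_% p) (sym (^-distribˡ-+-* x j j))) xᵏ≡1
  xʲ≢1 : ¬ (x ^ j ≡ 1 [mod p ])
  xʲ≢1 = minimal j (odd⇒>0 2∤j) (m<m+n j (odd⇒>0 2∤j))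

C₂-closure⇒odd : ∀ {n} → C₂-closure n → 2 ∤ n
C₂-closure⇒odd (prime p (_ , p%2≡1 , _)) = %2≡1⇒odd p%2≡1
C₂-closure⇒odd (mul c d)                 = odd-* (C₂-closure⇒odd c) (C₂-closure⇒odd d)

C₂-closure⇒>2 : ∀ {n} → C₂-closure n → 2 < n
C₂-closure⇒>2 (prime p (pp , p%2≡1 , _)) =
  ≤∧≢⇒< (nonTrivial⇒n>1 p {{prime⇒nonTrivial pp}}) λ { refl → 0≢1+n p%2≡1 }
C₂-closure⇒>2 (mul {m} {n} c d) =
  <-≤-trans (C₂-closure⇒>2 c) (m≤m*n m n {{>-nonZero (<-trans z<s (C₂-closure⇒>2 d))}})

C₂-closure⇒∣2^odd+1 : ∀ {n} → C₂-closure n → n ∣ 2 ^odd+1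
C₂-closure⇒∣2^odd+1 (prime p (pp , _ , ord)) = prime∧order≡2[mod4]⇒∣^odd+1 pp ord
C₂-closure⇒∣2^odd+1 (mul c d) =
  ∣^odd+1-* (C₂-closure⇒odd d) (C₂-closure⇒∣2^odd+1 c) (C₂-closure⇒∣2^odd+1 d)

lemma5 : (n : ℕ) → .{{_ : NonZero n}} → C₂-closure n →
    (∃[ k ] ((k % 2 ≡ 1) × (2 ^ k ≡ n ∸ 1 [mod n ])))
    × OrdMod4 n 2 2
lemma5 n c with C₂-closure⇒∣2^odd+1 c
... | a , 2∤a , n∣2ᵃ+1 =
  (a , odd⇒%2≡1 2∤a , ∣+1⇒≡-1 n∣2ᵃ+1) , odd-pow-∣+1⇒order≡2[mod4] (C₂-closure⇒>2 c) 2∤a n∣2ᵃ+1
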